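{- Let $A$ be a valise $(4,1)$ adinkra. Then (i) the identity $\mathbb{1}_8$ together with $\pi_{12}=\pi_{34}$, $\pi_{13}=\pi_{24}$, $\pi_{14}=\pi_{23}$ form a group isomorphic to the Klein four-group $K_4$; and (ii) the restrictions $\{\mathbb{1}_4,(\pi_{12})|_F,(\pi_{13})|_F,(\pi_{14})|_F\}$ to the fermions form a group isomorphic to $K_4$, and the same holds for the restrictions to the bosons.
   Context: Vertices: bosons $B=\{b_1,\dots,b_4\}$, fermions $F=\{f_1,\dots,f_4\}$. A valise $(4,1)$ adinkra is $K_{4,4}$ between $B$ and $F$ with edges colored by $\{1,2,3,4\}$ (each vertex has one edge of each color; any two colors form a disjoint union of $4$-cycles) and an odd dashing (every two-colored $4$-cycle has an odd number of dashed edges). For color $I$, $\pi_I$ is the permutation operator on $\mathbf{C}^{B\cup F}$ (an $8\times 8$ permutation matrix) sending each vertex to its neighbor along the edge of color $I$, and $\pi_{IJ}=\pi_I\pi_J$, which preserves $\mathbf{C}^F$ and $\mathbf{C}^B$; $(\cdot)|_F$, $(\cdot)|_B$ denote the restrictions to these subspaces. -}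

module Defs where

open import Data.Fin using (Fin; zero; suc)
open import Data.Bool using (Bool; true; false; _xor_)
open import Data.Product using (Σ; ∃; ∃!; _×_; _,_; proj₁)
open import Data.Sum using (_⊎_; inj₁; inj₂)
open import Relation.Binary.PropositionalEquality using (_≡_; _≢_; refl)

Boson : Set
Boson = Fin 4

Fermion : Set
Fermion = Fin 4

-- Colors {1,2,3,4} are indexed by Fin 4 (color k ↦ index k-1).
Color : Set
Color = Fin 4

c1 c2 c3 c4 : Color
c1 = zero
c2 = suc zero
c3 = suc (suc zero)
c4 = suc (suc (suc zero))

Vertex : Set
Vertex = Boson ⊎ Fermion

-- The underlying colored graph: K_{4,4}, i.e. the edge set is exactly
-- B × F, each edge (b , f) carrying a color, such that each vertex has
-- exactly one edge of each color.
record Coloring : Set where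
  field
    color     : Boson → Fermion → Color
    oneColorB : ∀ (b : Boson) (I : Color) → ∃! _≡_ (λ f → color b f ≡ I)
    oneColorF : ∀ (f : Fermion) (I : Color) → ∃! _≡_ (λ b → color b f ≡ I)

module _ (C : Coloring) where
  open Coloring C

  nbB : Color → Boson → Fermion
  nbB I b = proj₁ (oneColorB b I)

  nbF : Color → Fermion → Boson
  nbF I f = proj₁ (oneColorF f I)

  πc : Color → Vertex → Vertex
  πc I (inj₁ b) = inj₂ (nbB I b)
  πc I (inj₂ f) = inj₁ (nbF I f)

record Adinkra : Set where
  field
    coloring : Coloring
    dashed   : Boson → Fermion → Bool

  open Coloring coloring public

  π : Color → Vertex → Vertex
  π = πc coloring

  π₂ : Color → Color → Vertex → Vertex
  π₂ I J v = π I (π J v)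

  field
    -- any two distinct colors form a disjoint union of 4-cycles:
    -- following colors I, J, I, J from any vertex closes up after 4 steps
    -- (it cannot close after 2 steps since K_{4,4} is simple)
    twoColor4Cycles : ∀ (I J : Color) → I ≢ J → ∀ (v : Vertex) →
                      π J (π I (π J (π I v))) ≡ v
    -- odd dashing: the two-colored 4-cycle
    --   b —I— f₁ —J— b' —I— f₂ —J— b
    -- (every such cycle contains a boson b) has an odd number of dashed edges
    oddDashing : ∀ (I J : Color) → I ≢ J → ∀ (b : Boson) →
      let f₁ = nbB coloring I b
          b' = nbF coloring J f₁
          f₂ = nbB coloring I b'
      in (dashed b f₁ xor dashed b' f₁ xor dashed b' f₂ xor dashed b f₂) ≡ true

_≗_ : {A B : Set} → (A → B) → (A → B) → Set
f ≗ g = ∀ x → f x ≡ g x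

infix 4 _≗_

PreservesF : (Vertex → Vertex) → Set
PreservesF p = ∀ (f : Fermion) → Σ Fermion (λ f' → p (inj₂ f) ≡ inj₂ f')

PreservesB : (Vertex → Vertex) → Set
PreservesB p = ∀ (b : Boson) → Σ Boson (λ b' → p (inj₁ b) ≡ inj₁ b')

restrictF : (p : Vertex → Vertex) → PreservesF p → Fermion → Fermion
restrictF p h f = proj₁ (h f)

restrictB : (p : Vertex → Vertex) → PreservesB p → Boson → Boson
restrictB p h b = proj₁ (h b)

π₂-presF : (A : Adinkra) (I J : Color) → PreservesF (Adinkra.π₂ A I J)
π₂-presF A I J f = _ , refl

π₂-presB : (A : Adinkra) (I J : Color) → PreservesB (Adinkra.π₂ A I J)
π₂-presB A I J b = _ , refl

π₂|F : Adinkra → Color → Color → Fermion → Fermion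
π₂|F A I J = restrictF (Adinkra.π₂ A I J) (π₂-presF A I J)

π₂|B : Adinkra → Color → Color → Boson → Boson
π₂|B A I J = restrictB (Adinkra.π₂ A I J) (π₂-presB A I J)

K₄ : Set
K₄ = Bool × Bool

_⊕_ : K₄ → K₄ → K₄
(a , b) ⊕ (c , d) = (a xor c , b xor d)

-- The four elements e, a, b, c (under the operation _∙_, with equality _≈_)
-- form a group isomorphic to K₄: there is an injective homomorphism
-- K₄ → A whose image is exactly {e, a, b, c}.
record FormKlein {A : Set} (_≈_ : A → A → Set) (_∙_ : A → A → A)
                 (e a b c : A) : Set where
  field
    φ     : K₄ → A
    hom   : ∀ x y → φ (x ⊕ y) ≈ (φ x ∙ φ y)
    inj   : ∀ x y → φ x ≈ φ y → x ≡ y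
    image : ∀ x → φ x ≈ e ⊎ φ x ≈ a ⊎ φ x ≈ b ⊎ φ x ≈ c
    hitE  : ∃ λ x → φ x ≈ e
    hitA  : ∃ λ x → φ x ≈ a
    hitB  : ∃ λ x → φ x ≈ b
    hitC  : ∃ λ x → φ x ≈ c

_∘'_ : {A : Set} → (A → A) → (A → A) → A → A
(f ∘' g) x = f (g x)

id' : {A : Set} → A → A
id' x = x

module Submission where

-- On either side, πˣ I J = π_I π_J restricted there satisfies πˣ I J ∘ πˣ J K = πˣ I K,
-- πˣ I I = id, and, since two-coloured cycles have length 4, πˣ I J is an involution,
-- so πˣ I J = πˣ J I. Completeness of K₄,₄ makes M ↦ πˣ 1 M x a bijection from the
-- colours onto the side for each x; ruling out M = 1, 3, 4 in πˣ 3 4 x = πˣ 1 M x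
-- forces πˣ 3 4 = πˣ 1 2, and likewise for the other pairings. Then πˣ 1 2 and πˣ 1 3 are
-- commuting, fixed-point-free involutions with product πˣ 2 3 = πˣ 1 4, which is K₄.

open import Defs
open import Data.Bool using (Bool; true; false; _xor_)
open import Data.Bool.Properties using (xor-same)
open import Data.Empty using (⊥-elim)
open import Data.Fin using (zero; suc)
open import Data.Product using (_×_; _,_; proj₁; proj₂; ∃-syntax; ∃!)
open import Data.Sum using (_⊎_; inj₁; inj₂)
open import Data.Sum.Properties using (inj₁-injective; inj₂-injective)
open import Function using (_∘_; flip)
open import Relation.Binary.PropositionalEquality
  using (_≡_; _≢_; refl; sym; trans; cong; cong₂; module ≡-Reasoning)

⊎-ext : {A B C : Set} {f g : A ⊎ B → C} →
        (∀ a → f (inj₁ a) ≡ g (inj₁ a)) → (∀ b → f (inj₂ b) ≡ g (inj₂ b)) → f ≗ g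
⊎-ext h₁ h₂ (inj₁ a) = h₁ a
⊎-ext h₁ h₂ (inj₂ b) = h₂ b

xor≡false⇒≡ : ∀ a b → a xor b ≡ false → a ≡ b
xor≡false⇒≡ false false _ = refl
xor≡false⇒≡ true  true  _ = refl

⊕-same : ∀ x → x ⊕ x ≡ (false , false)
⊕-same (a , b) = cong₂ _,_ (xor-same a) (xor-same b)

⊕≡0⇒≡ : ∀ x y → x ⊕ y ≡ (false , false) → x ≡ y
⊕≡0⇒≡ (a , b) (c , d) e =
  cong₂ _,_ (xor≡false⇒≡ a c (cong proj₁ e)) (xor≡false⇒≡ b d (cong proj₂ e))

_^ᵇ_ : {X : Set} → (X → X) → Bool → X → X
t ^ᵇ false = id'
t ^ᵇ true  = t

^ᵇ-xor : {X : Set} {t : X → X} → t ∘' t ≗ id' →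
         ∀ a c → (t ^ᵇ a) ∘' (t ^ᵇ c) ≗ t ^ᵇ (a xor c)
^ᵇ-xor inv false c     x = refl
^ᵇ-xor inv true  false x = refl
^ᵇ-xor inv true  true  x = inv x

^ᵇ-commute : {X : Set} {s t : X → X} → s ∘' t ≗ t ∘' s →
             ∀ a c → (s ^ᵇ a) ∘' (t ^ᵇ c) ≗ (t ^ᵇ c) ∘' (s ^ᵇ a)
^ᵇ-commute comm false c     x = refl
^ᵇ-commute comm true  false x = refl
^ᵇ-commute comm true  true  x = comm x

commutingInvolutions⇒FormKlein :
  {X : Set} {t₁ t₂ t₃ : X → X} →
  t₁ ∘' t₁ ≗ id' → t₂ ∘' t₂ ≗ id' → t₁ ∘' t₂ ≗ t₂ ∘' t₁ → t₁ ∘' t₂ ≗ t₃ →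
  (x₀ : X) → t₁ x₀ ≢ x₀ → t₂ x₀ ≢ x₀ → t₃ x₀ ≢ x₀ →
  FormKlein _≗_ _∘'_ id' t₁ t₂ t₃
commutingInvolutions⇒FormKlein {X} {t₁} {t₂} {t₃} inv₁ inv₂ comm prod x₀ moves₁ moves₂ moves₃ =
  record
    { φ = φ ; hom = hom ; inj = inj ; image = image
    ; hitE = (false , false) , λ _ → refl
    ; hitA = (true , false) , λ _ → refl
    ; hitB = (false , true) , λ _ → refl
    ; hitC = (true , true) , prod
    }
  where
  open ≡-Reasoning

  φ : K₄ → X → X
  φ (a , b) = (t₁ ^ᵇ a) ∘' (t₂ ^ᵇ b)

  hom : ∀ x y → φ (x ⊕ y) ≗ φ x ∘' φ y
  hom (a , b) (c , d) z = begin
    (t₁ ^ᵇ (a xor c)) ((t₂ ^ᵇ (b xor d)) z)      ≡⟨ sym (^ᵇ-xor inv₁ a c _) ⟩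
    (t₁ ^ᵇ a) ((t₁ ^ᵇ c) ((t₂ ^ᵇ (b xor d)) z))  ≡⟨ cong ((t₁ ^ᵇ a) ∘ (t₁ ^ᵇ c)) (sym (^ᵇ-xor inv₂ b d z)) ⟩
    (t₁ ^ᵇ a) ((t₁ ^ᵇ c) ((t₂ ^ᵇ b) ((t₂ ^ᵇ d) z))) ≡⟨ cong (t₁ ^ᵇ a) (^ᵇ-commute comm c b _) ⟩
    (t₁ ^ᵇ a) ((t₂ ^ᵇ b) ((t₁ ^ᵇ c) ((t₂ ^ᵇ d) z))) ∎

  kernel-trivial : ∀ k → φ k x₀ ≡ x₀ → k ≡ (false , false)
  kernel-trivial (false , false) _ = refl
  kernel-trivial (true  , false) e = ⊥-elim (moves₁ e)
  kernel-trivial (false , true)  e = ⊥-elim (moves₂ e)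
  kernel-trivial (true  , true)  e = ⊥-elim (moves₃ (trans (sym (prod x₀)) e))

  inj : ∀ x y → φ x ≗ φ y → x ≡ y
  inj x y e = ⊕≡0⇒≡ x y (kernel-trivial (x ⊕ y) (begin
    φ (x ⊕ y) x₀     ≡⟨ hom x y x₀ ⟩
    φ x (φ y x₀)     ≡⟨ cong (φ x) (sym (e x₀)) ⟩
    φ x (φ x x₀)     ≡⟨ sym (hom x x x₀) ⟩
    φ (x ⊕ x) x₀     ≡⟨ cong (λ k → φ k x₀) (⊕-same x) ⟩
    x₀               ∎))

  image : ∀ x → φ x ≗ id' ⊎ φ x ≗ t₁ ⊎ φ x ≗ t₂ ⊎ φ x ≗ t₃
  image (false , false) = inj₁ λ _ → refl
  image (true  , false) = inj₂ (inj₁ λ _ → refl)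
  image (false , true)  = inj₂ (inj₂ (inj₁ λ _ → refl))
  image (true  , true)  = inj₂ (inj₂ (inj₂ prod))

-- πˣ I J is the restriction of π_I π_J to the side X.
module BipartiteColoring {X Y C : Set} (col : X → Y → C)
  (uniqueˣ : ∀ x I → ∃! _≡_ (λ y → col x y ≡ I))
  (uniqueʸ : ∀ y I → ∃! _≡_ (λ x → col x y ≡ I)) where

  nbˣ : C → X → Y
  nbˣ I x = proj₁ (uniqueˣ x I)

  nbʸ : C → Y → X
  nbʸ I y = proj₁ (uniqueʸ y I)

  πˣ : C → C → X → X
  πˣ I J x = nbʸ I (nbˣ J x)

  col-nbˣ : ∀ I x → col x (nbˣ I x) ≡ I
  col-nbˣ I x = proj₁ (proj₂ (uniqueˣ x I))

  col-nbʸ : ∀ I y → col (nbʸ I y) y ≡ I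
  col-nbʸ I y = proj₁ (proj₂ (uniqueʸ y I))

  nbˣ-unique : ∀ {I x y} → col x y ≡ I → nbˣ I x ≡ y
  nbˣ-unique {I} {x} = proj₂ (proj₂ (uniqueˣ x I))

  nbʸ-unique : ∀ {I x y} → col x y ≡ I → nbʸ I y ≡ x
  nbʸ-unique {I} {y = y} = proj₂ (proj₂ (uniqueʸ y I))

  nbʸ-nbˣ : ∀ I x → nbʸ I (nbˣ I x) ≡ x
  nbʸ-nbˣ I x = nbʸ-unique (col-nbˣ I x)

  nbˣ-nbʸ : ∀ I y → nbˣ I (nbʸ I y) ≡ y
  nbˣ-nbʸ I y = nbˣ-unique (col-nbʸ I y)

  πˣ-identity : ∀ I x → πˣ I I x ≡ x
  πˣ-identity = nbʸ-nbˣ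

  πˣ-trans : ∀ I J K x → πˣ I J (πˣ J K x) ≡ πˣ I K x
  πˣ-trans I J K x = cong (nbʸ I) (nbˣ-nbʸ J (nbˣ K x))

  πˣ-injectiveˡ : ∀ {I J K} x → πˣ I J x ≡ πˣ K J x → I ≡ K
  πˣ-injectiveˡ {I} {J} {K} x e = begin
    I                       ≡⟨ sym (col-nbʸ I y) ⟩
    col (nbʸ I y) y         ≡⟨ cong (λ z → col z y) e ⟩
    col (nbʸ K y) y         ≡⟨ col-nbʸ K y ⟩
    K                       ∎
    where
    open ≡-Reasoning
    y = nbˣ J x

  πˣ-injectiveʳ : ∀ {I J K} x → πˣ I J x ≡ πˣ I K x → J ≡ K
  πˣ-injectiveʳ {I} {J} {K} x e = begin
    J                       ≡⟨ sym (col-nbˣ J x) ⟩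
    col x (nbˣ J x)         ≡⟨ cong (col x) nbˣ-eq ⟩
    col x (nbˣ K x)         ≡⟨ col-nbˣ K x ⟩
    K                       ∎
    where
    open ≡-Reasoning
    nbˣ-eq : nbˣ J x ≡ nbˣ K x
    nbˣ-eq = trans (sym (nbˣ-nbʸ I (nbˣ J x))) (trans (cong (nbˣ I) e) (nbˣ-nbʸ I (nbˣ K x)))

  -- The graph is complete bipartite: x is joined to the I-neighbour of z by some edge.
  πˣ-surjective : ∀ I x z → ∃[ J ] πˣ I J x ≡ z
  πˣ-surjective I x z =
    col x (nbˣ I z) , trans (cong (nbʸ I) (nbˣ-unique refl)) (nbʸ-nbˣ I z)

  πˣ-fixedPointFree : ∀ {I J} → I ≢ J → ∀ x → πˣ I J x ≢ x
  πˣ-fixedPointFree I≢J x e = I≢J (πˣ-injectiveʳ x (trans (πˣ-identity _ x) (sym e)))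

  TwoColorFourCycles : Set
  TwoColorFourCycles = ∀ I J → I ≢ J → ∀ x → πˣ I J (πˣ I J x) ≡ x

  module TwoColorCycles (fourCycles : TwoColorFourCycles) where

    πˣ-sym : ∀ {I J} → I ≢ J → ∀ x → πˣ I J x ≡ πˣ J I x
    πˣ-sym {I} {J} I≢J x = begin
      πˣ I J x                       ≡⟨ sym (πˣ-identity J _) ⟩
      πˣ J J (πˣ I J x)              ≡⟨ sym (πˣ-trans J I J _) ⟩
      πˣ J I (πˣ I J (πˣ I J x))     ≡⟨ cong (πˣ J I) (fourCycles I J I≢J x) ⟩
      πˣ J I x                       ∎
      where open ≡-Reasoning

    πˣ-after : ∀ {I J} K → I ≢ J → πˣ I J ∘' πˣ I K ≗ πˣ J K
    πˣ-after {I} {J} K I≢J x = trans (πˣ-sym I≢J _) (πˣ-trans J I K x)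

    πˣ-otherPair : ∀ {I K L} → I ≢ K → I ≢ L → K ≢ L → ∀ x →
                   ∃[ M ] (M ≢ I × M ≢ K × M ≢ L) × πˣ I M x ≡ πˣ K L x
    πˣ-otherPair {I} {K} {L} I≢K I≢L K≢L x
      with M , e ← πˣ-surjective I x (πˣ K L x) = M , (M≢I , M≢K , M≢L) , e
      where
      M≢I : M ≢ I
      M≢I refl = K≢L (πˣ-injectiveˡ x (trans (sym e) (trans (πˣ-identity I x) (sym (πˣ-identity L x)))))
      M≢K : M ≢ K
      M≢K refl = I≢L (sym (πˣ-injectiveʳ x (trans (sym e) (πˣ-sym I≢K x))))
      M≢L : M ≢ L
      M≢L refl = I≢K (πˣ-injectiveˡ x e)

    πˣ-complementary : ∀ {I J K L} → I ≢ K → I ≢ L → K ≢ L →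
                       (∀ M → M ≢ I → M ≢ K → M ≢ L → M ≡ J) → πˣ I J ≗ πˣ K L
    πˣ-complementary I≢K I≢L K≢L onlyJ x
      with M , (M≢I , M≢K , M≢L) , e ← πˣ-otherPair I≢K I≢L K≢L x
      with refl ← onlyJ M M≢I M≢K M≢L = e

c2-only : ∀ M → M ≢ c1 → M ≢ c3 → M ≢ c4 → M ≡ c2
c2-only zero                   ≢c1 _   _   = ⊥-elim (≢c1 refl)
c2-only (suc zero)             _   _   _   = refl
c2-only (suc (suc zero))       _   ≢c3 _   = ⊥-elim (≢c3 refl)
c2-only (suc (suc (suc zero))) _   _   ≢c4 = ⊥-elim (≢c4 refl)

c3-only : ∀ M → M ≢ c1 → M ≢ c2 → M ≢ c4 → M ≡ c3
c3-only zero                   ≢c1 _   _   = ⊥-elim (≢c1 refl)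
c3-only (suc zero)             _   ≢c2 _   = ⊥-elim (≢c2 refl)
c3-only (suc (suc zero))       _   _   _   = refl
c3-only (suc (suc (suc zero))) _   _   ≢c4 = ⊥-elim (≢c4 refl)

c4-only : ∀ M → M ≢ c1 → M ≢ c2 → M ≢ c3 → M ≡ c4
c4-only zero                   ≢c1 _   _   = ⊥-elim (≢c1 refl)
c4-only (suc zero)             _   ≢c2 _   = ⊥-elim (≢c2 refl)
c4-only (suc (suc zero))       _   _   ≢c3 = ⊥-elim (≢c3 refl)
c4-only (suc (suc (suc zero))) _   _   _   = refl

module FourColoring {X Y : Set} (col : X → Y → Color)
  (uniqueˣ : ∀ x I → ∃! _≡_ (λ y → col x y ≡ I))
  (uniqueʸ : ∀ y I → ∃! _≡_ (λ x → col x y ≡ I))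
  (fourCycles : BipartiteColoring.TwoColorFourCycles col uniqueˣ uniqueʸ) where

  open BipartiteColoring col uniqueˣ uniqueʸ public
  open TwoColorCycles fourCycles

  πˣ₁₂≗πˣ₃₄ : πˣ c1 c2 ≗ πˣ c3 c4
  πˣ₁₂≗πˣ₃₄ = πˣ-complementary (λ ()) (λ ()) (λ ()) c2-only

  πˣ₁₃≗πˣ₂₄ : πˣ c1 c3 ≗ πˣ c2 c4
  πˣ₁₃≗πˣ₂₄ = πˣ-complementary (λ ()) (λ ()) (λ ()) c3-only

  πˣ₁₄≗πˣ₂₃ : πˣ c1 c4 ≗ πˣ c2 c3
  πˣ₁₄≗πˣ₂₃ = πˣ-complementary (λ ()) (λ ()) (λ ()) c4-only

  πˣ₁₂∘πˣ₁₃≗πˣ₁₄ : πˣ c1 c2 ∘' πˣ c1 c3 ≗ πˣ c1 c4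
  πˣ₁₂∘πˣ₁₃≗πˣ₁₄ x = trans (πˣ-after c3 (λ ()) x) (sym (πˣ₁₄≗πˣ₂₃ x))

  πˣ₁₂∘πˣ₁₃≗πˣ₁₃∘πˣ₁₂ : πˣ c1 c2 ∘' πˣ c1 c3 ≗ πˣ c1 c3 ∘' πˣ c1 c2
  πˣ₁₂∘πˣ₁₃≗πˣ₁₃∘πˣ₁₂ x =
    trans (πˣ-after c3 (λ ()) x) (trans (πˣ-sym (λ ()) x) (sym (πˣ-after c2 (λ ()) x)))

  πˣ-formKlein : X → FormKlein _≗_ _∘'_ id' (πˣ c1 c2) (πˣ c1 c3) (πˣ c1 c4)
  πˣ-formKlein x₀ = commutingInvolutions⇒FormKlein
    (fourCycles c1 c2 (λ ())) (fourCycles c1 c3 (λ ()))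
    πˣ₁₂∘πˣ₁₃≗πˣ₁₃∘πˣ₁₂ πˣ₁₂∘πˣ₁₃≗πˣ₁₄
    x₀ (πˣ-fixedPointFree (λ ()) x₀) (πˣ-fixedPointFree (λ ()) x₀) (πˣ-fixedPointFree (λ ()) x₀)

corollary3p5 : (A : Adinkra) →
    let open Adinkra A in
    -- (i)
    ( (π₂ c1 c2 ≗ π₂ c3 c4) × (π₂ c1 c3 ≗ π₂ c2 c4) × (π₂ c1 c4 ≗ π₂ c2 c3)
      × FormKlein _≗_ _∘'_ id' (π₂ c1 c2) (π₂ c1 c3) (π₂ c1 c4) )
    -- (ii)
    × FormKlein _≗_ _∘'_ id' (π₂|F A c1 c2) (π₂|F A c1 c3) (π₂|F A c1 c4)
    × FormKlein _≗_ _∘'_ id' (π₂|B A c1 c2) (π₂|B A c1 c3) (π₂|B A c1 c4)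
corollary3p5 A =
  ( ⊎-ext (cong inj₁ ∘ B.πˣ₁₂≗πˣ₃₄) (cong inj₂ ∘ F.πˣ₁₂≗πˣ₃₄)
  , ⊎-ext (cong inj₁ ∘ B.πˣ₁₃≗πˣ₂₄) (cong inj₂ ∘ F.πˣ₁₃≗πˣ₂₄)
  , ⊎-ext (cong inj₁ ∘ B.πˣ₁₄≗πˣ₂₃) (cong inj₂ ∘ F.πˣ₁₄≗πˣ₂₃)
  , commutingInvolutions⇒FormKlein
      (⊎-ext (cong inj₁ ∘ bosonCycles c1 c2 (λ ())) (cong inj₂ ∘ fermionCycles c1 c2 (λ ())))
      (⊎-ext (cong inj₁ ∘ bosonCycles c1 c3 (λ ())) (cong inj₂ ∘ fermionCycles c1 c3 (λ ())))
      (⊎-ext (cong inj₁ ∘ B.πˣ₁₂∘πˣ₁₃≗πˣ₁₃∘πˣ₁₂) (cong inj₂ ∘ F.πˣ₁₂∘πˣ₁₃≗πˣ₁₃∘πˣ₁₂))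
      (⊎-ext (cong inj₁ ∘ B.πˣ₁₂∘πˣ₁₃≗πˣ₁₄) (cong inj₂ ∘ F.πˣ₁₂∘πˣ₁₃≗πˣ₁₄))
      (inj₁ zero)
      (B.πˣ-fixedPointFree (λ ()) zero ∘ inj₁-injective)
      (B.πˣ-fixedPointFree (λ ()) zero ∘ inj₁-injective)
      (B.πˣ-fixedPointFree (λ ()) zero ∘ inj₁-injective) )
  , F.πˣ-formKlein zero
  , B.πˣ-formKlein zero
  where
  open Adinkra A
  bosonCycles : BipartiteColoring.TwoColorFourCycles color oneColorB oneColorF
  bosonCycles I J I≢J b = inj₁-injective (twoColor4Cycles J I (I≢J ∘ sym) (inj₁ b))

  fermionCycles : BipartiteColoring.TwoColorFourCycles (flip color) oneColorF oneColorB
  fermionCycles I J I≢J f = inj₂-injective (twoColor4Cycles J I (I≢J ∘ sym) (inj₂ f))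

  module B = FourColoring color oneColorB oneColorF bosonCycles
  module F = FourColoring (flip color) oneColorF oneColorB fermionCycles
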